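{- For every $n\ge1$, $$|U_n| = n! - \sum_{k=1}^{n} |I_k|.$$
   Context: $[n]=\{1,\dots,n\}$, $S_n$ is the group of bijections $[n]\to[n]$. For $w\in S_n$, $i_w$ is the smallest $k\in[n]$ with $w([k])=[k]$; $w$ is irreducible if $i_w=n$. $I_k$ is the set of irreducible permutations in $S_k$. $U_n:=\{w\in S_n : \text{there is } i>i_w \text{ with } w(i)\neq i\}$. -}

module Defs where

open import Data.Nat using (ℕ; zero; suc; _≤_; _<_)
open import Data.Fin using (Fin; toℕ)
open import Data.Fin.Properties using (_≟_)
open import Data.Vec using (Vec; lookup; toList)
open import Data.List using (List; map; upTo)
open import Data.Nat.ListAction using (sum)
open import Data.Bool using (T)
open import Data.Product using (Σ; ∃; _×_)
open import Relation.Nullary using (¬_)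
open import Relation.Nullary.Decidable using (⌊_⌋)
open import Relation.Binary.PropositionalEquality using (_≡_; _≢_)
import Data.List.Relation.Unary.Unique.DecPropositional as UniqueDec

-- A permutation of [n] in one-line notation: a vector (w(1),…,w(n)) of
-- elements of [n] with no repeated entry (i.e. w is injective, hence a
-- bijection [n] → [n]).  [n] is represented by Fin n (0-based: the
-- element j of [n] is the Fin n with toℕ = j - 1).  The side condition is
-- a boolean test, so two permutations are equal iff their one-line
-- notations are equal.
isPerm : ∀ {n} → Vec (Fin n) n → Set
isPerm v = T ⌊ UniqueDec.unique? _≟_ (toList v) ⌋

S : ℕ → Set
S n = Σ (Vec (Fin n) n) isPerm

app : ∀ {n} → S n → Fin n → Fin n
app (v Data.Product., _) i = lookup v i

-- w([k]) = [k]  (as sets; [k] ⊆ [n] corresponds to Fin n elements with toℕ < k)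
Fixes : ∀ {n} → S n → ℕ → Set
Fixes {n} w k =
  (∀ (i : Fin n) → toℕ i < k → toℕ (app w i) < k)
  × (∀ (j : Fin n) → toℕ j < k → ∃ λ (i : Fin n) → toℕ i < k × app w i ≡ j)

IsIw : ∀ {n} → S n → ℕ → Set
IsIw {n} w k = 1 ≤ k × k ≤ n × Fixes w k × (∀ k′ → 1 ≤ k′ → k′ < k → ¬ Fixes w k′)

Irreducible : ∀ {n} → S n → Set
Irreducible {n} w = IsIw w n

-- w ∈ U_n : there is i ∈ [n] with i > i_w and w(i) ≠ i.
-- (the 1-based index of a Fin element i is toℕ i + 1, so "i > i_w" is  i_w ≤ toℕ i)
InU : ∀ {n} → S n → Set
InU {n} w = ∃ λ k → IsIw w k × (∃ λ (i : Fin n) → k ≤ toℕ i × app w i ≢ i)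

-- |{ a ∈ A | P a }| = m : an explicit duplicate-free enumeration of length m
-- of exactly the elements of A satisfying P.
CountOf : (A : Set) → (A → Set) → ℕ → Set
CountOf A P m =
  Σ (Vec A m) λ xs →
    (∀ i j → lookup xs i ≡ lookup xs j → i ≡ j)
    × (∀ i → P (lookup xs i))
    × (∀ a → P a → ∃ λ i → lookup xs i ≡ a)

sum1to : ℕ → (ℕ → ℕ) → ℕ
sum1to n c = sum (map (λ i → c (suc i)) (upTo n))

module Submission where

-- Every w ∈ Sₙ has a unique i_w.  If w ∉ Uₙ then w is the identity beyond i_w = k, so w = σ ⊕ id
-- with σ ∈ I_k, and conversely every σ ⊕ id with σ ∈ I_k lies outside Uₙ with i_w = k.  Hence Sₙ
-- is the disjoint union of Uₙ and of copies of I_1, …, I_n, and |Uₙ| + Σ_k |I_k| = |Sₙ| = n!.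

open import Defs
open import Data.Bool.Properties using (T-irrelevant)
open import Data.Empty using (⊥-elim)
open import Data.Fin using (Fin; zero; suc; toℕ; fromℕ<; _↑ˡ_; _↑ʳ_; splitAt; join; punchIn; punchOut)
open import Data.Fin.Properties
  using (_≟_; any?; all?; toℕ<n; toℕ-injective; toℕ-fromℕ<; toℕ-↑ˡ; toℕ-↑ʳ; ↑ˡ-injective;
         splitAt-↑ˡ; splitAt-↑ʳ; splitAt⁻¹-↑ˡ; splitAt⁻¹-↑ʳ; +↔⊎; *↔×; 0≢1+n; suc-injective;
         punchInᵢ≢i; punchIn-injective; punchOut-injective; punchIn-punchOut; punchOut-punchIn;
         punchOut-cong; injective⇒≤; <⇒notInjective)
open import Data.List using (upTo; map; [_]; _++_)
open import Data.List.Properties using (map-++; upTo-∷ʳ)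
import Data.List.Relation.Unary.AllPairs as List
open import Data.Nat using (ℕ; zero; suc; _+_; _≤_; _<_; _!; _∸_; z≤n; s≤s; _≤?_; _<?_)
open import Data.Nat.ListAction using (sum)
open import Data.Nat.ListAction.Properties using (sum-++)
open import Data.Nat.Properties
  using (≤-refl; ≤-antisym; <⇒≤; m≤n⇒m≤1+n; <⇒≱; <-≤-trans; <-cmp; m≤m+n; n<1+n; m<n⇒m<1+n;
         m<1+n⇒m<n∨m≡n; m≤n⇒m<n∨m≡n; 1+n≰n; +-identityʳ; m+[n∸m]≡n; m+n∸n≡m)
open import Data.Product using (∃; _×_; _,_; proj₁; proj₂)
open import Data.Product.Function.NonDependent.Propositional using (_×-↔_)
open import Data.Sum as Sum using (_⊎_; inj₁; inj₂)
open import Data.Sum.Properties using (inj₁-injective)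
open import Data.Unit using (tt)
open import Data.Vec using (Vec; []; _∷_; lookup; tabulate; toList)
open import Data.Vec.Properties using (lookup∘tabulate; tabulate∘lookup; tabulate-cong)
import Data.Vec.Relation.Unary.All.Properties as All
import Data.Vec.Relation.Unary.AllPairs as Vec
open import Data.Vec.Relation.Unary.Unique.Propositional.Properties using (lookup-injective; tabulate⁺)
open import Function using (_∘_; _↔_; Injection; Inverse; mk↔ₛ′)
open import Function.Definitions using (Injective)
open import Function.Properties.Inverse using (↔-refl; ↔-sym; ↔-trans; ↔⇒↣)
open import Level using (0ℓ)
open import Relation.Binary.Core using (Rel)
open import Relation.Binary.Definitions using (tri<; tri≈; tri>)
open import Relation.Binary.PropositionalEquality
  using (_≡_; _≢_; refl; sym; trans; cong; subst; module ≡-Reasoning)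
open import Relation.Nullary using (¬_; Dec; yes; no; contradiction; ¬?)
open import Relation.Nullary.Decidable using (toWitness; fromWitness; _×-dec_; _→-dec_)
open import Relation.Unary using (Pred; Decidable; U; _⊆′_; _≐′_; _∪_; _⊥′_)

open ≡-Reasoning

record Enumeration (A : Set) (P : Pred A 0ℓ) (I : Set) : Set where
  field
    elem           : I → A
    elem-injective : Injective _≡_ _≡_ elem
    elem-∈         : ∀ i → P (elem i)
    elem-onto      : ∀ {a} → P a → ∃ λ i → elem i ≡ a

open Enumeration

module _ {A : Set} where

  fromCountOf : ∀ {P m} → CountOf A P m → Enumeration A P (Fin m)
  fromCountOf (xs , injective , sound , complete) = record
    { elem = lookup xs ; elem-injective = injective _ _ ; elem-∈ = sound ; elem-onto = complete _ }

  enumerateAll : ∀ {I} → I ↔ A → Enumeration A U I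
  enumerateAll I↔A = record
    { elem = to ; elem-injective = Injection.injective (↔⇒↣ I↔A) ; elem-∈ = λ _ → tt
    ; elem-onto = λ {a} _ → from a , strictlyInverseˡ a }
    where open Inverse I↔A

  reindex : ∀ {P I J} → I ↔ J → Enumeration A P J → Enumeration A P I
  reindex I↔J E = record
    { elem = elem E ∘ to
    ; elem-injective = Injection.injective (↔⇒↣ I↔J) ∘ elem-injective E
    ; elem-∈ = elem-∈ E ∘ to
    ; elem-onto = λ Pa → let j , ej = elem-onto E Pa in from j , trans (cong (elem E) (strictlyInverseˡ j)) ej }
    where open Inverse I↔J

  Enumeration-resp-≐′ : ∀ {P Q I} → P ≐′ Q → Enumeration A P I → Enumeration A Q I
  Enumeration-resp-≐′ (P⊆Q , Q⊆P) E = record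
    { elem = elem E ; elem-injective = elem-injective E
    ; elem-∈ = λ i → P⊆Q _ (elem-∈ E i) ; elem-onto = λ Qa → elem-onto E (Q⊆P _ Qa) }

  union : ∀ {P Q I J} → P ⊥′ Q → Enumeration A P I → Enumeration A Q J → Enumeration A (P ∪ Q) (I ⊎ J)
  union {P} {Q} P⊥Q E F = record
    { elem = Sum.[ elem E , elem F ] ; elem-injective = injective ; elem-∈ = sound ; elem-onto = complete }
    where
    apart : ∀ i j → elem E i ≢ elem F j
    apart i j e = P⊥Q _ (elem-∈ E i , subst Q (sym e) (elem-∈ F j))
    injective : Injective _≡_ _≡_ Sum.[ elem E , elem F ]
    injective {inj₁ i} {inj₁ i′} e = cong inj₁ (elem-injective E e)
    injective {inj₁ i} {inj₂ j}  e = ⊥-elim (apart i j e)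
    injective {inj₂ j} {inj₁ i}  e = ⊥-elim (apart i j (sym e))
    injective {inj₂ j} {inj₂ j′} e = cong inj₂ (elem-injective F e)
    sound : ∀ x → (P ∪ Q) (Sum.[ elem E , elem F ] x)
    sound (inj₁ i) = inj₁ (elem-∈ E i)
    sound (inj₂ j) = inj₂ (elem-∈ F j)
    complete : ∀ {a} → (P ∪ Q) a → ∃ λ x → Sum.[ elem E , elem F ] x ≡ a
    complete (inj₁ Pa) = let i , e = elem-onto E Pa in inj₁ i , e
    complete (inj₂ Qa) = let j , e = elem-onto F Qa in inj₂ j , e

  image : ∀ {B : Set} {P Q I} (g : B → A) → Injective _≡_ _≡_ g →
          (∀ {b} → Q b → P (g b)) → (∀ {a} → P a → ∃ λ b → Q b × g b ≡ a) →
          Enumeration B Q I → Enumeration A P I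
  image g g-injective Q⇒P P⇒Q E = record
    { elem = g ∘ elem E ; elem-injective = elem-injective E ∘ g-injective
    ; elem-∈ = Q⇒P ∘ elem-∈ E
    ; elem-onto = λ Pa → let b , Qb , eb = P⇒Q Pa ; i , ei = elem-onto E Qb in i , trans (cong g ei) eb }

  Enumeration-card-mono : ∀ {P Q m n} → P ⊆′ Q →
                          Enumeration A P (Fin m) → Enumeration A Q (Fin n) → m ≤ n
  Enumeration-card-mono {m = m} {n} P⊆Q E F = injective⇒≤ {f = index} index-injective
    where
    located : ∀ i → ∃ λ j → elem F j ≡ elem E i
    located i = elem-onto F (P⊆Q _ (elem-∈ E i))
    index : Fin m → Fin n
    index = proj₁ ∘ located
    index-injective : Injective _≡_ _≡_ index
    index-injective {i} {j} e = elem-injective E (begin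
      elem E i          ≡⟨ proj₂ (located i) ⟨
      elem F (index i)  ≡⟨ cong (elem F) e ⟩
      elem F (index j)  ≡⟨ proj₂ (located j) ⟩
      elem E j          ∎)

  Enumeration-card-unique : ∀ {P Q m n} → P ≐′ Q →
                            Enumeration A P (Fin m) → Enumeration A Q (Fin n) → m ≡ n
  Enumeration-card-unique (P⊆Q , Q⊆P) E F =
    ≤-antisym (Enumeration-card-mono P⊆Q E F) (Enumeration-card-mono Q⊆P F E)

AllPairs-toList⁻ : ∀ {A : Set} {R : Rel A 0ℓ} {n} {xs : Vec A n} →
                   List.AllPairs R (toList xs) → Vec.AllPairs R xs
AllPairs-toList⁻ {xs = []}    List.[]              = Vec.[]
AllPairs-toList⁻ {xs = _ ∷ _} (x~xs List.∷ xs~xs) = All.toList⁻ x~xs Vec.∷ AllPairs-toList⁻ xs~xs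

AllPairs-toList⁺ : ∀ {A : Set} {R : Rel A 0ℓ} {n} {xs : Vec A n} →
                   Vec.AllPairs R xs → List.AllPairs R (toList xs)
AllPairs-toList⁺ Vec.[]              = List.[]
AllPairs-toList⁺ (x~xs Vec.∷ xs~xs) = All.toList⁺ x~xs List.∷ AllPairs-toList⁺ xs~xs

fromInjection : ∀ {n} (f : Fin n → Fin n) → Injective _≡_ _≡_ f → S n
fromInjection f f-injective = tabulate f , fromWitness (AllPairs-toList⁺ (tabulate⁺ f-injective))

app-injective : ∀ {n} (w : S n) → Injective _≡_ _≡_ (app w)
app-injective (v , isPerm-v) = lookup-injective (AllPairs-toList⁻ (toWitness isPerm-v)) _ _

S-ext : ∀ {n} {w w′ : S n} → (∀ i → app w i ≡ app w′ i) → w ≡ w′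
S-ext {w = v , p} {v′ , p′} eq
  with refl ← trans (sym (tabulate∘lookup v)) (trans (tabulate-cong eq) (tabulate∘lookup v′))
  = cong (v ,_) (T-irrelevant p p′)

injective⇒surjective : ∀ {n} {f : Fin n → Fin n} → Injective _≡_ _≡_ f → ∀ j → ∃ λ i → f i ≡ j
injective⇒surjective {suc n} {f} f-injective j with any? (λ i → f i ≟ j)
... | yes hit  = hit
... | no  miss = ⊥-elim (<⇒notInjective {f = g} (n<1+n n) g-injective)
  where
  j≢f : ∀ i → j ≢ f i
  j≢f i e = miss (i , sym e)
  g : Fin (suc n) → Fin n
  g i = punchOut (j≢f i)
  g-injective : Injective _≡_ _≡_ g
  g-injective e = f-injective (punchOut-injective (j≢f _) (j≢f _) e)

-- Sₙ ↔ Fin n!, by splitting off the image of the first point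

module _ {n : ℕ} where

  prepend : Fin (suc n) → S n → Fin (suc n) → Fin (suc n)
  prepend a w zero    = a
  prepend a w (suc j) = punchIn a (app w j)

  prepend-injective : ∀ a w → Injective _≡_ _≡_ (prepend a w)
  prepend-injective a w {zero}  {zero}  _ = refl
  prepend-injective a w {zero}  {suc j} e = ⊥-elim (punchInᵢ≢i a (app w j) (sym e))
  prepend-injective a w {suc i} {zero}  e = ⊥-elim (punchInᵢ≢i a (app w i) e)
  prepend-injective a w {suc i} {suc j} e = cong suc (app-injective w (punchIn-injective a _ _ e))

  cons : Fin (suc n) × S n → S (suc n)
  cons (a , w) = fromInjection (prepend a w) (prepend-injective a w)

  module _ (w : S (suc n)) where

    head≢ : ∀ j → app w zero ≢ app w (suc j)
    head≢ j = 0≢1+n ∘ app-injective w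

    tail : S n
    tail = fromInjection (λ j → punchOut (head≢ j))
      (λ e → suc-injective (app-injective w (punchOut-injective (head≢ _) (head≢ _) e)))

  uncons : S (suc n) → Fin (suc n) × S n
  uncons w = app w zero , tail w

  cons-uncons : ∀ w → cons (uncons w) ≡ w
  cons-uncons w = S-ext λ where
    zero    → refl
    (suc j) → begin
      app (cons (uncons w)) (suc j)                ≡⟨ lookup∘tabulate (prepend (app w zero) (tail w)) (suc j) ⟩
      punchIn (app w zero) (app (tail w) j)        ≡⟨ cong (punchIn (app w zero)) (lookup∘tabulate _ j) ⟩
      punchIn (app w zero) (punchOut (head≢ w j))  ≡⟨ punchIn-punchOut (head≢ w j) ⟩
      app w (suc j)                                ∎

  uncons-cons : ∀ aw → uncons (cons aw) ≡ aw
  uncons-cons (a , w) = cong (a ,_) (S-ext λ j → begin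
    app (tail (cons (a , w))) j              ≡⟨ lookup∘tabulate _ j ⟩
    punchOut (head≢ (cons (a , w)) j)        ≡⟨ punchOut-cong a (lookup∘tabulate (prepend a w) (suc j)) ⟩
    punchOut (punchInᵢ≢i a (app w j) ∘ sym)  ≡⟨ punchOut-punchIn a ⟩
    app w j                                  ∎)

S↔Fin[n!] : ∀ n → S n ↔ Fin (n !)
S↔Fin[n!] zero    = mk↔ₛ′ (λ _ → zero) (λ _ → [] , tt) (λ { zero → refl }) (λ { ([] , _) → refl })
S↔Fin[n!] (suc n) =
  ↔-trans (mk↔ₛ′ uncons cons uncons-cons cons-uncons) (↔-trans (↔-refl ×-↔ S↔Fin[n!] n) (↔-sym *↔×))

Fixes? : ∀ {n} (w : S n) k → Dec (Fixes w k)
Fixes? w k =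
  all? (λ i → (toℕ i <? k) →-dec (toℕ (app w i) <? k))
  ×-dec all? (λ j → (toℕ j <? k) →-dec any? (λ i → (toℕ i <? k) ×-dec (app w i ≟ j)))

Fixes-whole : ∀ {n} (w : S n) → Fixes w n
Fixes-whole w =
  (λ i _ → toℕ<n (app w i)) ,
  (λ j _ → let i , e = injective⇒surjective (app-injective w) j in i , toℕ<n i , e)

module _ {ℓ} {P : Pred ℕ ℓ} (P? : Decidable P) where

  least-or-none : ∀ n → (∃ λ k → k < n × P k × (∀ {j} → j < k → ¬ P j)) ⊎ (∀ {j} → j < n → ¬ P j)
  least-or-none zero = inj₂ λ ()
  least-or-none (suc n) with least-or-none n
  ... | inj₁ (k , k<n , Pk , below) = inj₁ (k , m<n⇒m<1+n k<n , Pk , below)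
  ... | inj₂ none with P? n
  ...   | yes Pn = inj₁ (n , n<1+n n , Pn , none)
  ...   | no ¬Pn = inj₂ λ j<1+n → Sum.[ none , (λ { refl → ¬Pn }) ] (m<1+n⇒m<n∨m≡n j<1+n)

  least : ∀ {n} → P n → ∃ λ k → k ≤ n × P k × (∀ {j} → j < k → ¬ P j)
  least {n} Pn with least-or-none (suc n)
  ... | inj₁ (k , s≤s k≤n , Pk , below) = k , k≤n , Pk , below
  ... | inj₂ none = contradiction Pn (none (n<1+n n))

IsIw-exists : ∀ {n} (w : S n) → 1 ≤ n → ∃ (IsIw w)
IsIw-exists w 1≤n with least (λ k → (1 ≤? k) ×-dec Fixes? w k) (1≤n , Fixes-whole w)
... | k , k≤n , (1≤k , fixes) , below = k , 1≤k , k≤n , fixes , λ k′ 1≤k′ k′<k fx → below k′<k (1≤k′ , fx)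

IsIw-unique : ∀ {n} (w : S n) {k k′} → IsIw w k → IsIw w k′ → k ≡ k′
IsIw-unique w {k} {k′} (1≤k , _ , fixes , minimal) (1≤k′ , _ , fixes′ , minimal′) with <-cmp k k′
... | tri< k<k′ _ _ = contradiction fixes (minimal′ k 1≤k k<k′)
... | tri≈ _ k≡k′ _ = k≡k′
... | tri> _ _ k′<k = contradiction fixes′ (minimal k′ 1≤k′ k′<k)

-- Sₙ ∖ Uₙ: the permutations that are the identity beyond i_w

FixedFrom : ∀ {n} → ℕ → S n → Set
FixedFrom {n} k w = ∀ (i : Fin n) → k ≤ toℕ i → app w i ≡ i

-- Named for the decomposition w = σ ⊕ id with σ ∈ I_k established below.
Irreducible⊕id : ∀ {n} → ℕ → S n → Set
Irreducible⊕id k w = IsIw w k × FixedFrom k w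

Irreducible⊕id≤ : ∀ {n} → ℕ → S n → Set
Irreducible⊕id≤ m w = ∃ λ k → k ≤ m × Irreducible⊕id k w

InU⊥Irreducible⊕id≤ : ∀ {n m} → InU {n} ⊥′ Irreducible⊕id≤ m
InU⊥Irreducible⊕id≤ w ((k , iw , i , k≤i , moved) , (_ , _ , iw′ , fixed))
  with refl ← IsIw-unique w iw iw′ = moved (fixed i k≤i)

InU∪Irreducible⊕id≤≐′U : ∀ {n} → 1 ≤ n → InU {n} ∪ Irreducible⊕id≤ n ≐′ U
InU∪Irreducible⊕id≤≐′U {n} 1≤n = (λ _ _ → tt) , covered
  where
  covered : U ⊆′ InU {n} ∪ Irreducible⊕id≤ n
  covered w _ with IsIw-exists w 1≤n
  ... | k , iw@(_ , k≤n , _) with any? (λ i → (k ≤? toℕ i) ×-dec ¬? (app w i ≟ i))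
  ...   | yes (i , k≤i , moved) = inj₁ (k , iw , i , k≤i , moved)
  ...   | no nothing-moved = inj₂ (k , k≤n , iw , fixed)
    where
    fixed : FixedFrom k w
    fixed i k≤i with app w i ≟ i
    ... | yes fixes = fixes
    ... | no moved  = ⊥-elim (nothing-moved (i , k≤i , moved))

-- The direct sum σ ⊕ id of σ ∈ S k with the identity of [d]

data Split {k d : ℕ} : Fin (k + d) → Set where
  left  : (a : Fin k) → Split (a ↑ˡ d)
  right : (b : Fin d) → Split (k ↑ʳ b)

module _ {k d : ℕ} where

  split : (i : Fin (k + d)) → Split i
  split i with splitAt k i in eq
  ... | inj₁ a = subst Split (splitAt⁻¹-↑ˡ eq) (left a)
  ... | inj₂ b = subst Split (splitAt⁻¹-↑ʳ eq) (right b)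

  ↑ˡ<k : (a : Fin k) → toℕ (a ↑ˡ d) < k
  ↑ˡ<k a = subst (_< k) (sym (toℕ-↑ˡ a d)) (toℕ<n a)

  k≤↑ʳ : (b : Fin d) → k ≤ toℕ (k ↑ʳ b)
  k≤↑ʳ b = subst (k ≤_) (sym (toℕ-↑ʳ k b)) (m≤m+n k (toℕ b))

  ↑ʳ≮ : ∀ {j} (b : Fin d) → j ≤ k → ¬ toℕ (k ↑ʳ b) < j
  ↑ʳ≮ b j≤k b<j = <⇒≱ (<-≤-trans b<j j≤k) (k≤↑ʳ b)

  map₁-injective : ∀ {f : Fin k → Fin k} → Injective _≡_ _≡_ f →
                   Injective _≡_ _≡_ (Sum.map₁ {B = Fin d} f)
  map₁-injective f-injective {inj₁ _} {inj₁ _} e    = cong inj₁ (f-injective (inj₁-injective e))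
  map₁-injective f-injective {inj₁ _} {inj₂ _} ()
  map₁-injective f-injective {inj₂ _} {inj₁ _} ()
  map₁-injective f-injective {inj₂ _} {inj₂ _} refl = refl

  _⊕id : S k → S (k + d)
  σ ⊕id = fromInjection (join k d ∘ Sum.map₁ (app σ) ∘ splitAt k)
    ( Injection.injective (↔⇒↣ (+↔⊎ {k} {d}))
    ∘ map₁-injective (app-injective σ)
    ∘ Injection.injective (↔⇒↣ (↔-sym (+↔⊎ {k} {d}))))

  ⊕id-↑ˡ : ∀ σ a → app (σ ⊕id) (a ↑ˡ d) ≡ app σ a ↑ˡ d
  ⊕id-↑ˡ σ a = trans (lookup∘tabulate _ (a ↑ˡ d)) (cong (join k d ∘ Sum.map₁ (app σ)) (splitAt-↑ˡ k a d))

  ⊕id-↑ʳ : ∀ σ b → app (σ ⊕id) (k ↑ʳ b) ≡ k ↑ʳ b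
  ⊕id-↑ʳ σ b = trans (lookup∘tabulate _ (k ↑ʳ b)) (cong (join k d ∘ Sum.map₁ (app σ)) (splitAt-↑ʳ k d b))

  toℕ-⊕id-↑ˡ : ∀ σ a → toℕ (app (σ ⊕id) (a ↑ˡ d)) ≡ toℕ (app σ a)
  toℕ-⊕id-↑ˡ σ a = trans (cong toℕ (⊕id-↑ˡ σ a)) (toℕ-↑ˡ (app σ a) d)

  ⊕id-injective : Injective _≡_ _≡_ _⊕id
  ⊕id-injective {σ} {σ′} e = S-ext λ a → ↑ˡ-injective d _ _ (begin
    app σ a ↑ˡ d           ≡⟨ ⊕id-↑ˡ σ a ⟨
    app (σ ⊕id) (a ↑ˡ d)   ≡⟨ cong (λ τ → app τ (a ↑ˡ d)) e ⟩
    app (σ′ ⊕id) (a ↑ˡ d)  ≡⟨ ⊕id-↑ˡ σ′ a ⟩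
    app σ′ a ↑ˡ d          ∎)

  ⊕id-FixedFrom : ∀ σ → FixedFrom k (σ ⊕id)
  ⊕id-FixedFrom σ i k≤i with split i
  ... | left a  = contradiction k≤i (<⇒≱ (↑ˡ<k a))
  ... | right b = ⊕id-↑ʳ σ b

  ⊕id-Fixes⁺ : ∀ σ {j} → j ≤ k → Fixes σ j → Fixes (σ ⊕id) j
  ⊕id-Fixes⁺ σ {j} j≤k (into , onto) = into′ , onto′
    where
    into′ : ∀ i → toℕ i < j → toℕ (app (σ ⊕id) i) < j
    into′ i i<j with split i
    ... | left a  = subst (_< j) (sym (toℕ-⊕id-↑ˡ σ a)) (into a (subst (_< j) (toℕ-↑ˡ a d) i<j))
    ... | right b = contradiction i<j (↑ʳ≮ b j≤k)
    onto′ : ∀ i → toℕ i < j → ∃ λ i′ → toℕ i′ < j × app (σ ⊕id) i′ ≡ i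
    onto′ i i<j with split i
    ... | right b = contradiction i<j (↑ʳ≮ b j≤k)
    ... | left a with onto a (subst (_< j) (toℕ-↑ˡ a d) i<j)
    ...   | a′ , a′<j , σa′≡a =
      a′ ↑ˡ d , subst (_< j) (sym (toℕ-↑ˡ a′ d)) a′<j , trans (⊕id-↑ˡ σ a′) (cong (_↑ˡ d) σa′≡a)

  ⊕id-Fixes⁻ : ∀ σ {j} → j ≤ k → Fixes (σ ⊕id) j → Fixes σ j
  ⊕id-Fixes⁻ σ {j} j≤k (into , onto) = into′ , onto′
    where
    into′ : ∀ a → toℕ a < j → toℕ (app σ a) < j
    into′ a a<j = subst (_< j) (toℕ-⊕id-↑ˡ σ a) (into (a ↑ˡ d) (subst (_< j) (sym (toℕ-↑ˡ a d)) a<j))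
    onto′ : ∀ a → toℕ a < j → ∃ λ a′ → toℕ a′ < j × app σ a′ ≡ a
    onto′ a a<j with onto (a ↑ˡ d) (subst (_< j) (sym (toℕ-↑ˡ a d)) a<j)
    ... | i , i<j , e with split i
    ...   | right b = contradiction i<j (↑ʳ≮ b j≤k)
    ...   | left a′ = a′ , subst (_< j) (toℕ-↑ˡ a′ d) i<j , ↑ˡ-injective d _ _ (trans (sym (⊕id-↑ˡ σ a′)) e)

  ⊕id-IsIw⁺ : ∀ σ → Irreducible σ → IsIw (σ ⊕id) k
  ⊕id-IsIw⁺ σ (1≤k , _ , fixes , minimal) =
    1≤k , m≤m+n k d , ⊕id-Fixes⁺ σ ≤-refl fixes ,
    λ k′ 1≤k′ k′<k → minimal k′ 1≤k′ k′<k ∘ ⊕id-Fixes⁻ σ (<⇒≤ k′<k)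

  ⊕id-IsIw⁻ : ∀ σ → IsIw (σ ⊕id) k → Irreducible σ
  ⊕id-IsIw⁻ σ (1≤k , _ , fixes , minimal) =
    1≤k , ≤-refl , ⊕id-Fixes⁻ σ ≤-refl fixes ,
    λ k′ 1≤k′ k′<k → minimal k′ 1≤k′ k′<k ∘ ⊕id-Fixes⁺ σ (<⇒≤ k′<k)

  module _ (w : S (k + d)) (into : ∀ i → toℕ i < k → toℕ (app w i) < k) where

    restrict : S k
    restrict = fromInjection (λ a → fromℕ< (into (a ↑ˡ d) (↑ˡ<k a))) λ {a} {a′} e →
      ↑ˡ-injective d _ _ (app-injective w (toℕ-injective (begin
        toℕ (app w (a ↑ˡ d))                     ≡⟨ toℕ-fromℕ< _ ⟨
        toℕ (fromℕ< (into (a ↑ˡ d) (↑ˡ<k a)))    ≡⟨ cong toℕ e ⟩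
        toℕ (fromℕ< (into (a′ ↑ˡ d) (↑ˡ<k a′)))  ≡⟨ toℕ-fromℕ< _ ⟩
        toℕ (app w (a′ ↑ˡ d))                    ∎)))

    restrict-⊕id : FixedFrom k w → restrict ⊕id ≡ w
    restrict-⊕id fixed = S-ext λ i → on (split i)
      where
      on : ∀ {i} → Split i → app (restrict ⊕id) i ≡ app w i
      on (left a)  = toℕ-injective (begin
        toℕ (app (restrict ⊕id) (a ↑ˡ d)) ≡⟨ toℕ-⊕id-↑ˡ restrict a ⟩
        toℕ (app restrict a)              ≡⟨ cong toℕ (lookup∘tabulate _ a) ⟩
        toℕ (fromℕ< _)                    ≡⟨ toℕ-fromℕ< _ ⟩
        toℕ (app w (a ↑ˡ d))              ∎)
      on (right b) = trans (⊕id-↑ʳ restrict b) (sym (fixed (k ↑ʳ b) (k≤↑ʳ b)))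

  Irreducible⊕id-enumeration : ∀ {c} → CountOf (S k) Irreducible c →
                               Enumeration (S (k + d)) (Irreducible⊕id k) (Fin c)
  Irreducible⊕id-enumeration count =
    image _⊕id ⊕id-injective (λ {σ} irreducible → ⊕id-IsIw⁺ σ irreducible , ⊕id-FixedFrom σ) preimage
      (fromCountOf count)
    where
    preimage : ∀ {w} → Irreducible⊕id k w → ∃ λ σ → Irreducible σ × σ ⊕id ≡ w
    preimage {w} (iw@(_ , _ , (into , _) , _) , fixed) =
      restrict w into ,
      ⊕id-IsIw⁻ (restrict w into) (subst (λ τ → IsIw τ k) (sym (restrict-⊕id w into fixed)) iw) ,
      restrict-⊕id w into fixed

sum1to-suc : ∀ m c → sum1to (suc m) c ≡ sum1to m c + c (suc m)
sum1to-suc m c = begin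
  sum (map c′ (upTo (suc m)))        ≡⟨ cong (sum ∘ map c′) (upTo-∷ʳ m) ⟨
  sum (map c′ (upTo m ++ [ m ]))     ≡⟨ cong sum (map-++ c′ (upTo m) [ m ]) ⟩
  sum (map c′ (upTo m) ++ [ c′ m ])  ≡⟨ sum-++ (map c′ (upTo m)) [ c′ m ] ⟩
  sum1to m c + (c (suc m) + 0)       ≡⟨ cong (sum1to m c +_) (+-identityʳ (c (suc m))) ⟩
  sum1to m c + c (suc m)             ∎
  where
  c′ : ℕ → ℕ
  c′ i = c (suc i)

module _ {n : ℕ} {c : ℕ → ℕ} (counts : ∀ k → 1 ≤ k → k ≤ n → CountOf (S k) Irreducible (c k)) where

  Irreducible⊕id-enumerationₙ : ∀ k → 1 ≤ k → k ≤ n → Enumeration (S n) (Irreducible⊕id k) (Fin (c k))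
  Irreducible⊕id-enumerationₙ k 1≤k k≤n =
    subst (λ N → Enumeration (S N) (Irreducible⊕id k) (Fin (c k))) (m+[n∸m]≡n k≤n)
      (Irreducible⊕id-enumeration (counts k 1≤k k≤n))

  Irreducible⊕id≤-enumeration : ∀ m → m ≤ n → Enumeration (S n) (Irreducible⊕id≤ m) (Fin (sum1to m c))
  Irreducible⊕id≤-enumeration zero _ = record
    { elem = λ () ; elem-injective = λ { {()} } ; elem-∈ = λ ()
    ; elem-onto = λ { (_ , k≤0 , (1≤k , _) , _) → contradiction (<-≤-trans 1≤k k≤0) λ () } }
  Irreducible⊕id≤-enumeration (suc m) 1+m≤n =
    subst (λ s → Enumeration (S n) (Irreducible⊕id≤ (suc m)) (Fin s)) (sym (sum1to-suc m c))
      (reindex +↔⊎ (Enumeration-resp-≐′ peel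
        (union disjoint (Irreducible⊕id≤-enumeration m (<⇒≤ 1+m≤n))
                        (Irreducible⊕id-enumerationₙ (suc m) (s≤s z≤n) 1+m≤n))))
    where
    peel : Irreducible⊕id≤ m ∪ Irreducible⊕id (suc m) ≐′ Irreducible⊕id≤ (suc m)
    peel = grow , shrink
      where
      grow : Irreducible⊕id≤ m ∪ Irreducible⊕id (suc m) ⊆′ Irreducible⊕id≤ (suc m)
      grow _ (inj₁ (k , k≤m , v)) = k , m≤n⇒m≤1+n k≤m , v
      grow _ (inj₂ v)             = suc m , ≤-refl , v
      shrink : Irreducible⊕id≤ (suc m) ⊆′ Irreducible⊕id≤ m ∪ Irreducible⊕id (suc m)
      shrink _ (k , k≤1+m , v) with m≤n⇒m<n∨m≡n k≤1+m
      ... | inj₁ (s≤s k≤m) = inj₁ (k , k≤m , v)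
      ... | inj₂ refl      = inj₂ v
    disjoint : Irreducible⊕id≤ m ⊥′ Irreducible⊕id (suc m)
    disjoint w ((k , k≤m , iw , _) , (iw′ , _)) with refl ← IsIw-unique w iw iw′ = 1+n≰n k≤m

theorem4 : ∀ (n : ℕ) → 1 ≤ n →
    ∀ (u : ℕ) (c : ℕ → ℕ) →
    CountOf (S n) InU u →
    (∀ k → 1 ≤ k → k ≤ n → CountOf (S k) Irreducible (c k)) →
    u ≡ n ! ∸ sum1to n c
theorem4 n 1≤n u c countU counts = begin
  u          ≡⟨ m+n∸n≡m u s ⟨
  u + s ∸ s  ≡⟨ cong (_∸ s) u+s≡n! ⟩
  n ! ∸ s    ∎
  where
  s : ℕ
  s = sum1to n c
  u+s≡n! : u + s ≡ n !
  u+s≡n! = Enumeration-card-unique (InU∪Irreducible⊕id≤≐′U 1≤n)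
    (reindex +↔⊎ (union InU⊥Irreducible⊕id≤ (fromCountOf countU) (Irreducible⊕id≤-enumeration counts n ≤-refl)))
    (enumerateAll (↔-sym (S↔Fin[n!] n)))
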